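{- Let $A$ be a pseudo-BCI algebra and let $d$ be a type II implicative derivation on $A$. Then $d$ is regular (i.e. $d(1)=1$) if and only if every deductive system $D$ of $A$ is $d$-invariant, i.e. satisfies $d(D)\subseteq D$.
   Context: A pseudo-BCI algebra is a structure $(A,\to,\rightsquigarrow,1)$ of type $(2,2,0)$ such that for all $x,y,z\in A$: $(x\to y)\rightsquigarrow[(y\to z)\rightsquigarrow(x\to z)]=1$; $(x\rightsquigarrow y)\to[(y\rightsquigarrow z)\to(x\rightsquigarrow z)]=1$; $1\to x=x$; $1\rightsquigarrow x=x$; and $x\to y=1$, $y\to x=1$ imply $x=y$. Put $x\Cup_1 y=(x\to y)\rightsquigarrow y$ and $x\Cup_2 y=(x\rightsquigarrow y)\to y$. A map $d:A\to A$ is a type II implicative derivation if $d(x\to y)=(d(x)\to y)\Cup_2(x\to d(y))$ and $d(x\rightsquigarrow y)=(d(x)\rightsquigarrow y)\Cup_1(x\rightsquigarrow d(y))$ for all $x,y\in A$. A deductive system of $A$ is a subset $D\subseteq A$ with $1\in D$ such that $x\in D$ and $x\to y\in D$ imply $y\in D$. -}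

module Defs where

open import Level using (Level; suc; _⊔_)
open import Relation.Binary.PropositionalEquality using (_≡_)
open import Relation.Unary using (Pred; _∈_; _⊆_)
open import Data.Product using (_×_)

record PseudoBCI (a : Level) : Set (suc a) where
  infixr 25 _⇒_ _⇝_
  field
    Carrier : Set a
    _⇒_     : Carrier → Carrier → Carrier
    _⇝_     : Carrier → Carrier → Carrier
    𝟏       : Carrier
    ax1 : ∀ x y z → ((x ⇒ y) ⇝ ((y ⇒ z) ⇝ (x ⇒ z))) ≡ 𝟏
    ax2 : ∀ x y z → ((x ⇝ y) ⇒ ((y ⇝ z) ⇒ (x ⇝ z))) ≡ 𝟏
    ax3 : ∀ x → (𝟏 ⇒ x) ≡ x
    ax4 : ∀ x → (𝟏 ⇝ x) ≡ x
    ax5 : ∀ x y → (x ⇒ y) ≡ 𝟏 → (y ⇒ x) ≡ 𝟏 → x ≡ y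

  _⋓₁_ : Carrier → Carrier → Carrier
  x ⋓₁ y = (x ⇒ y) ⇝ y

  _⋓₂_ : Carrier → Carrier → Carrier
  x ⋓₂ y = (x ⇝ y) ⇒ y

module _ {a : Level} (A : PseudoBCI a) where
  open PseudoBCI A

  IsTypeIIImplicativeDerivation : (Carrier → Carrier) → Set a
  IsTypeIIImplicativeDerivation d =
    (∀ x y → d (x ⇒ y) ≡ ((d x ⇒ y) ⋓₂ (x ⇒ d y))) ×
    (∀ x y → d (x ⇝ y) ≡ ((d x ⇝ y) ⋓₁ (x ⇝ d y)))

  IsRegular : (Carrier → Carrier) → Set a
  IsRegular d = d 𝟏 ≡ 𝟏

  IsDeductiveSystem : {ℓ : Level} → Pred Carrier ℓ → Set (a ⊔ ℓ)
  IsDeductiveSystem D = (𝟏 ∈ D) × (∀ x y → x ∈ D → (x ⇒ y) ∈ D → y ∈ D)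

  IsInvariant : {ℓ : Level} → (Carrier → Carrier) → Pred Carrier ℓ → Set (a ⊔ ℓ)
  IsInvariant d D = ∀ x → x ∈ D → d x ∈ D

-- A regular derivation satisfies d x = (x ⇝ d x) → d x (put 1 for x in the defining
-- identity for →), and every deductive system contains (x ⇝ y) → y along with x,
-- because x → ((x ⇝ y) → y) = 1.  Conversely {1} is a deductive system, and its
-- d-invariance is exactly d 1 = 1.
module Submission where

open import Defs
open import Level using (Level)
open import Relation.Unary using (Pred; _∈_)
open import Function.Bundles using (_⇔_; mk⇔)
open import Relation.Binary.PropositionalEquality
open import Data.Product using (_,_)

module _ {a : Level} (A : PseudoBCI a) where
  open PseudoBCI A

  x⇒x⋓₂y≡𝟏 : ∀ x y → (x ⇒ (x ⋓₂ y)) ≡ 𝟏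
  x⇒x⋓₂y≡𝟏 x y =
    subst (_≡ 𝟏) (cong₂ (λ u v → u ⇒ ((x ⇝ y) ⇒ v)) (ax4 x) (ax4 y)) (ax2 𝟏 x y)

  deductiveSystem-⋓₂-closed : ∀ {ℓ} {D : Pred Carrier ℓ} → IsDeductiveSystem A D →
                              ∀ {x} y → x ∈ D → (x ⋓₂ y) ∈ D
  deductiveSystem-⋓₂-closed {D = D} (𝟏∈D , mp) {x} y x∈D =
    mp x _ x∈D (subst (_∈ D) (sym (x⇒x⋓₂y≡𝟏 x y)) 𝟏∈D)

  singleton-𝟏-isDeductiveSystem : IsDeductiveSystem A (_≡ 𝟏)
  singleton-𝟏-isDeductiveSystem = refl , λ { x y refl 𝟏⇒y≡𝟏 → trans (sym (ax3 y)) 𝟏⇒y≡𝟏 }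

  regular-derivation-≡⋓₂ : ∀ {d} → IsTypeIIImplicativeDerivation A d → IsRegular A d →
                           ∀ x → d x ≡ x ⋓₂ d x
  regular-derivation-≡⋓₂ {d} (d-⇒ , _) d𝟏≡𝟏 x = begin
    d x                        ≡⟨ cong d (sym (ax3 x)) ⟩
    d (𝟏 ⇒ x)                  ≡⟨ d-⇒ 𝟏 x ⟩
    (d 𝟏 ⇒ x) ⋓₂ (𝟏 ⇒ d x)     ≡⟨ cong (λ u → (u ⇒ x) ⋓₂ (𝟏 ⇒ d x)) d𝟏≡𝟏 ⟩
    (𝟏 ⇒ x) ⋓₂ (𝟏 ⇒ d x)       ≡⟨ cong₂ _⋓₂_ (ax3 x) (ax3 (d x)) ⟩
    x ⋓₂ d x                   ∎
    where open ≡-Reasoning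

corollary3p29 : {a : Level} (A : PseudoBCI a) (d : PseudoBCI.Carrier A → PseudoBCI.Carrier A) →
    IsTypeIIImplicativeDerivation A d →
    (IsRegular A d ⇔ ((D : Pred (PseudoBCI.Carrier A) a) → IsDeductiveSystem A D → IsInvariant A d D))
corollary3p29 A d isDerivation = mk⇔ invariant regular
  where
  open PseudoBCI A

  invariant : IsRegular A d → (D : Pred Carrier _) → IsDeductiveSystem A D → IsInvariant A d D
  invariant d𝟏≡𝟏 D isDS x x∈D =
    subst (_∈ D) (sym (regular-derivation-≡⋓₂ A isDerivation d𝟏≡𝟏 x))
          (deductiveSystem-⋓₂-closed A isDS (d x) x∈D)

  regular : ((D : Pred Carrier _) → IsDeductiveSystem A D → IsInvariant A d D) → IsRegular A d
  regular allInvariant = allInvariant (_≡ 𝟏) (singleton-𝟏-isDeductiveSystem A) 𝟏 refl
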